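{- Let $G$ be a $2$-connected graph and let $G'$ be a non-empty connected subgraph of $G$ such that $G'$ contains all vertices of degree at least $4$ in $G$ and $G-V(G')$ contains at least one cycle. Then $G-V(G')$ contains an induced cycle $C$ such that $G-V(C)$ is connected.
   Context: All graphs are simple and finite. -}

module Defs where

open import Data.Nat as ℕ using (ℕ; zero; suc; _≤_; _≥_)
open import Data.Fin using (Fin; zero; suc; toℕ; fromℕ<)
open import Data.Bool using (Bool; true; false; T; if_then_else_)
open import Data.List using (List; map; allFin)
open import Data.Nat.ListAction using (sum)
open import Data.Product using (Σ; ∃; ∃-syntax; _×_; _,_)
open import Data.Sum using (_⊎_)
open import Data.Unit using (⊤)
open import Relation.Nullary using (¬_; yes; no)
open import Relation.Binary.PropositionalEquality using (_≡_)
open import Function.Definitions using (Injective)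

record Graph : Set where
  field
    n      : ℕ
    adj    : Fin n → Fin n → Bool
    sym    : ∀ u v → adj u v ≡ adj v u
    irrefl : ∀ v → adj v v ≡ false

module _ (G : Graph) where
  open Graph G

  Vertex : Set
  Vertex = Fin n

  Adj : Vertex → Vertex → Set
  Adj u v = T (adj u v)

  degree : Vertex → ℕ
  degree v = sum (map (λ u → if adj v u then 1 else 0) (allFin n))

  data Walk (U : Vertex → Set) (R : Vertex → Vertex → Set) : Vertex → Vertex → Set where
    nil  : ∀ {u} → U u → Walk U R u u
    cons : ∀ {u w v} → U u → R u w → Walk U R w v → Walk U R u v

  ConnectedOn : (Vertex → Set) → (Vertex → Vertex → Set) → Set
  ConnectedOn U R = (∃[ v ] U v) × (∀ u v → U u → U v → Walk U R u v)

  Connected : Set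
  Connected = ConnectedOn (λ _ → ⊤) Adj

  TwoConnected : Set
  TwoConnected = (n ≥ 3) × Connected × (∀ x → ConnectedOn (λ v → ¬ v ≡ x) Adj)

  record Subgraph : Set₁ where
    field
      V       : Vertex → Set
      E       : Vertex → Vertex → Set
      E-sym   : ∀ {u v} → E u v → E v u
      E-adj   : ∀ {u v} → E u v → Adj u v
      E-left  : ∀ {u v} → E u v → V u
      E-right : ∀ {u v} → E u v → V v

  SubgraphConnected : Subgraph → Set
  SubgraphConnected H = ConnectedOn (Subgraph.V H) (Subgraph.E H)

csuc : ∀ {m} → Fin (suc m) → Fin (suc m)
csuc {m} i with toℕ i ℕ.<? m
... | yes p = suc (fromℕ< p)
... | no _  = zero

module _ (G : Graph) where
  open Graph G

  -- a cycle of G: distinct vertices c 0, ..., c m (length m+1 ≥ 3) with c i adjacent to c (i+1 mod (m+1))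
  record Cycle : Set where
    field
      m     : ℕ
      len≥3 : suc m ≥ 3
      c     : Fin (suc m) → Fin n
      inj   : Injective _≡_ _≡_ c
      edges : ∀ i → Adj G (c i) (c (csuc i))

  OnCycle : Cycle → Fin n → Set
  OnCycle C v = ∃[ i ] Cycle.c C i ≡ v

  CycleAvoids : (Fin n → Set) → Cycle → Set
  CycleAvoids U C = ∀ i → ¬ U (Cycle.c C i)

  Induced : Cycle → Set
  Induced C = ∀ i j → Adj G (Cycle.c C i) (Cycle.c C j) → (j ≡ csuc i) ⊎ (i ≡ csuc j)

-- Induct on the size of the component K of G − F containing G′, for induced cycles F of G − V(G′)
-- (G′ is connected and disjoint from F); the given cycle, with its chords cut, is a starting point.
-- If G − F is disconnected, pick u outside F ∪ K
-- and rotate F so that its last vertex x has a neighbour in K. The component of u attaches to F (G is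
-- connected) and, avoiding that first attachment vertex, at a second one (G minus a vertex is
-- connected); neither is x, since x already has two cycle neighbours and one in K and has degree < 4
-- (it is not in G′). The arc of F between the two attachments that avoids x, closed up through the
-- component of u, is a cycle disjoint from K ∪ {x}; cutting its chords keeps it so and makes it
-- induced. For the new cycle the component of G′ contains K and x, so K strictly grows.
module Submission where

open import Defs
open import Data.Bool using (Bool; true; false; T; not; if_then_else_)
open import Data.Empty using (⊥; ⊥-elim)
open import Data.Fin as F using (Fin; toℕ; fromℕ<)
open import Data.Fin.Properties using (toℕ-injective; toℕ-fromℕ<; toℕ≤pred[n]; any?)
open import Data.List using (map; allFin; tabulate; _∷_)
open import Data.List.Properties using (map-tabulate)
open import Data.Nat as ℕ using (ℕ; zero; suc; pred; _+_; _∸_; _≤_; _<_; _≥_; z≤n; s≤s; >-nonZero)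
open import Data.Nat.Induction using (<-wellFounded)
open import Data.Nat.ListAction using (sum)
open import Data.Nat.Properties
open import Data.Product using (Σ; ∃; ∃-syntax; _×_; _,_; proj₁; proj₂)
open import Data.Sum using (_⊎_; inj₁; inj₂)
open import Data.Unit using (⊤; tt)
open import Function using (_∘_; id)
open import Induction.WellFounded using (Acc; acc)
open import Relation.Binary.Definitions using (tri<; tri≈; tri>)
open import Relation.Binary.PropositionalEquality
open import Relation.Nullary using (¬_; Dec; yes; no)
open import Relation.Nullary.Decidable using (T?; ¬?; _×-dec_; ⌊_⌋; map′; toWitness; fromWitness)

¬T⇒T-not : ∀ {b} → ¬ T b → T (not b)
¬T⇒T-not {false} _ = tt
¬T⇒T-not {true} ¬t = ¬t tt

T-not⇒¬T : ∀ {b} → T (not b) → ¬ T b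
T-not⇒¬T {false} _ ()

indicator : Bool → ℕ
indicator b = if b then 1 else 0

count : ∀ {k} → (Fin k → Bool) → ℕ
count {k} p = sum (map (indicator ∘ p) (allFin k))

count-suc : ∀ {k} (p : Fin (suc k) → Bool) → count p ≡ indicator (p F.zero) + count (p ∘ F.suc)
count-suc {k} p = cong sum (begin
  map g (tabulate id)             ≡⟨ map-tabulate id g ⟩
  g F.zero ∷ tabulate (g ∘ F.suc)  ≡⟨ cong (g F.zero ∷_) (map-tabulate id (g ∘ F.suc)) ⟨
  g F.zero ∷ map (g ∘ F.suc) (allFin k) ∎)
  where
    open ≡-Reasoning
    g : Fin (suc k) → ℕ
    g = indicator ∘ p

indicator-mono : ∀ {a b} → (T a → T b) → indicator a ≤ indicator b
indicator-mono {false} _ = z≤n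
indicator-mono {true} {true} _ = ≤-refl
indicator-mono {true} {false} h = ⊥-elim (h tt)

indicator-strict : ∀ {a b} → ¬ T a → T b → indicator a < indicator b
indicator-strict {false} {true} _ _ = s≤s z≤n
indicator-strict {true} ¬a _ = ⊥-elim (¬a tt)

indicator≤1 : ∀ b → indicator b ≤ 1
indicator≤1 true = ≤-refl
indicator≤1 false = z≤n

count-mono : ∀ {k} {p q : Fin k → Bool} → (∀ i → T (p i) → T (q i)) → count p ≤ count q
count-mono {zero} _ = z≤n
count-mono {suc k} {p} {q} p⊆q rewrite count-suc p | count-suc q =
  +-mono-≤ (indicator-mono (p⊆q F.zero)) (count-mono (p⊆q ∘ F.suc))

count-strict : ∀ {k} {p q : Fin k → Bool} → (∀ i → T (p i) → T (q i)) →
  ∀ j → ¬ T (p j) → T (q j) → count p < count q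
count-strict {suc k} {p} {q} p⊆q F.zero ¬pj qj rewrite count-suc p | count-suc q =
  +-mono-<-≤ (indicator-strict ¬pj qj) (count-mono (p⊆q ∘ F.suc))
count-strict {suc k} {p} {q} p⊆q (F.suc j) ¬pj qj rewrite count-suc p | count-suc q =
  +-mono-≤-< (indicator-mono (p⊆q F.zero)) (count-strict (p⊆q ∘ F.suc) j ¬pj qj)

count≤ : ∀ {k} (p : Fin k → Bool) → count p ≤ k
count≤ {zero} _ = z≤n
count≤ {suc k} p rewrite count-suc p = +-mono-≤ (indicator≤1 (p F.zero)) (count≤ (p ∘ F.suc))

_without_ : ∀ {k} → (Fin k → Bool) → Fin k → Fin k → Bool
(p without x) w with w F.≟ x
... | yes _ = false
... | no _ = p w

without-⁺ : ∀ {k} (p : Fin k → Bool) {x w} → T (p w) → ¬ w ≡ x → T ((p without x) w)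
without-⁺ p {x} {w} pw w≢x with w F.≟ x
... | yes w≡x = w≢x w≡x
... | no _ = pw

without-⁻ : ∀ {k} (p : Fin k → Bool) x {w} → T ((p without x) w) → T (p w) × ¬ w ≡ x
without-⁻ p x {w} t with w F.≟ x
... | no w≢x = t , w≢x

count-without : ∀ {k} (p : Fin k → Bool) {x} → T (p x) → count (p without x) < count p
count-without p {x} px = count-strict (λ i → proj₁ ∘ without-⁻ p x) x (λ t → proj₂ (without-⁻ p x t) refl) px

count-without-⁺ : ∀ {k} (p : Fin k → Bool) {x r} → T (p x) → r ≤ count (p without x) → suc r ≤ count p
count-without-⁺ p {x} px r≤ = ≤-trans (s≤s r≤) (count-without p {x} px)

four≤count : ∀ {k} {p : Fin k → Bool} {a b c d} → T (p a) → T (p b) → T (p c) → T (p d) →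
  ¬ a ≡ b → ¬ a ≡ c → ¬ a ≡ d → ¬ b ≡ c → ¬ b ≡ d → ¬ c ≡ d → 4 ≤ count p
four≤count {p = p} {a} {b} {c} {d} pa pb pc pd a≢b a≢c a≢d b≢c b≢d c≢d =
  count-without-⁺ p pa (count-without-⁺ (p without a) (without-⁺ p pb (a≢b ∘ sym))
    (count-without-⁺ ((p without a) without b) (without-⁺ _ (without-⁺ p pc (a≢c ∘ sym)) (b≢c ∘ sym))
      (count-without-⁺ (((p without a) without b) without c) {d}
        (without-⁺ _ (without-⁺ _ (without-⁺ p pd (a≢d ∘ sym)) (b≢d ∘ sym)) (c≢d ∘ sym)) z≤n)))

search : ∀ {k} {P Q : Fin k → Set} → (∀ i → P i ⊎ Q i) → ∃ P ⊎ (∀ i → Q i)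
search {zero} _ = inj₂ λ ()
search {suc k} d with d F.zero | search (d ∘ F.suc)
... | inj₁ p | _ = inj₁ (F.zero , p)
... | inj₂ _ | inj₁ (i , p) = inj₁ (F.suc i , p)
... | inj₂ q | inj₂ qs = inj₂ λ { F.zero → q ; (F.suc i) → qs i }

toℕ-csuc : ∀ {m} {i : Fin (suc m)} → toℕ i < m → toℕ (csuc i) ≡ suc (toℕ i)
toℕ-csuc {m} {i} i<m with toℕ i ℕ.<? m
... | yes i<m′ = cong suc (toℕ-fromℕ< i<m′)
... | no i≮m = ⊥-elim (i≮m i<m)

csuc-last : ∀ {m} {i : Fin (suc m)} → ¬ toℕ i < m → csuc i ≡ F.zero
csuc-last {m} {i} i≮m with toℕ i ℕ.<? m
... | yes i<m = ⊥-elim (i≮m i<m)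
... | no _ = refl

m<n∧n≢1+m⇒2≤n∸m : ∀ {m n} → m < n → ¬ n ≡ suc m → 2 ≤ n ∸ m
m<n∧n≢1+m⇒2≤n∸m {zero} {suc zero} _ n≢1 = ⊥-elim (n≢1 refl)
m<n∧n≢1+m⇒2≤n∸m {zero} {suc (suc n)} _ _ = s≤s (s≤s z≤n)
m<n∧n≢1+m⇒2≤n∸m {suc m} {suc n} (s≤s m<n) n≢ = m<n∧n≢1+m⇒2≤n∸m m<n (n≢ ∘ cong suc)

m<n≤o⇒n∸m<o : ∀ {m n o} → m < n → n ≤ o → ¬ (m ≡ 0 × n ≡ o) → n ∸ m < o
m<n≤o⇒n∸m<o {zero} _ n≤o ¬ends = ≤∧≢⇒< n≤o (λ n≡o → ¬ends (refl , n≡o))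
m<n≤o⇒n∸m<o {suc m} {suc n} _ n≤o _ = <-≤-trans (s≤s (m∸n≤m n m)) n≤o

cyclic-suc : ℕ → ℕ → ℕ
cyclic-suc m k with k ℕ.<? m
... | yes _ = suc k
... | no _ = 0

cyclic-suc-< : ∀ {m k} → k < m → cyclic-suc m k ≡ suc k
cyclic-suc-< {m} {k} k<m with k ℕ.<? m
... | yes _ = refl
... | no k≮m = ⊥-elim (k≮m k<m)

cyclic-suc-last : ∀ m → cyclic-suc m m ≡ 0
cyclic-suc-last m with m ℕ.<? m
... | yes m<m = ⊥-elim (<-irrefl refl m<m)
... | no _ = refl

cyclic-suc-≤ : ∀ {m k} → k ≤ m → cyclic-suc m k ≤ m
cyclic-suc-≤ {m} {k} k≤m with m≤n⇒m<n∨m≡n k≤m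
... | inj₁ k<m = subst (_≤ m) (sym (cyclic-suc-< k<m)) k<m
... | inj₂ refl = subst (_≤ m) (sym (cyclic-suc-last m)) z≤n

cyclic-suc-injective : ∀ {m i j} → i ≤ m → j ≤ m → cyclic-suc m i ≡ cyclic-suc m j → i ≡ j
cyclic-suc-injective {m} {i} {j} i≤m j≤m e with m≤n⇒m<n∨m≡n i≤m | m≤n⇒m<n∨m≡n j≤m
... | inj₁ i<m | inj₁ j<m = suc-injective (trans (sym (cyclic-suc-< i<m)) (trans e (cyclic-suc-< j<m)))
... | inj₁ i<m | inj₂ refl = ⊥-elim (1+n≢0 (trans (sym (cyclic-suc-< i<m)) (trans e (cyclic-suc-last m))))
... | inj₂ refl | inj₁ j<m = ⊥-elim (1+n≢0 (trans (sym (cyclic-suc-< j<m)) (trans (sym e) (cyclic-suc-last m))))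
... | inj₂ refl | inj₂ refl = refl

cyclic-suc-surjective : ∀ {m k} → k ≤ m → Σ ℕ λ k′ → k′ ≤ m × cyclic-suc m k′ ≡ k
cyclic-suc-surjective {m} {zero} _ = m , ≤-refl , cyclic-suc-last m
cyclic-suc-surjective {m} {suc k} k<m = k , <⇒≤ k<m , cyclic-suc-< k<m

module _ (G : Graph) where
  open Graph G using (n; adj; irrefl) renaming (sym to adj-sym)

  infix 4 _~_
  _~_ : Vertex G → Vertex G → Set
  _~_ = Adj G

  ~-sym : ∀ {u v} → u ~ v → v ~ u
  ~-sym {u} {v} a rewrite adj-sym u v = a

  ~-irrefl : ∀ {u v} → u ~ v → ¬ u ≡ v
  ~-irrefl {u} a refl rewrite irrefl u = a

  module _ {U : Vertex G → Set} {R : Vertex G → Vertex G → Set} where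

    walk-start : ∀ {x y} → Walk G U R x y → U x
    walk-start (nil ux) = ux
    walk-start (cons ux _ _) = ux

    walk-end : ∀ {x y} → Walk G U R x y → U y
    walk-end (nil uy) = uy
    walk-end (cons _ _ w) = walk-end w

    infixr 5 _++ʷ_
    _++ʷ_ : ∀ {x y z} → Walk G U R x y → Walk G U R y z → Walk G U R x z
    nil _ ++ʷ w = w
    cons ux r v ++ʷ w = cons ux r (v ++ʷ w)

    snocʷ : ∀ {x y z} → Walk G U R x y → R y z → U z → Walk G U R x z
    snocʷ w r uz = w ++ʷ cons (walk-end w) r (nil uz)

    reverseʷ : (∀ {x y} → R x y → R y x) → ∀ {x y} → Walk G U R x y → Walk G U R y x
    reverseʷ R-sym (nil ux) = nil ux
    reverseʷ R-sym (cons ux r w) = snocʷ (reverseʷ R-sym w) (R-sym r) ux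

    walk-exit : (Q : Vertex G → Bool) → ∀ {x y} → Walk G U R x y → T (Q x) → ¬ T (Q y) →
      Σ (Vertex G) λ p → Σ (Vertex G) λ q → U p × U q × R p q × T (Q p) × ¬ T (Q q)
    walk-exit Q (nil _) Qx ¬Qy = ⊥-elim (¬Qy Qx)
    walk-exit Q (cons {w = w} ux r v) Qx ¬Qy with Q w in Qw
    ... | true = walk-exit Q v (subst T (sym Qw) tt) ¬Qy
    ... | false = _ , w , ux , walk-start v , r , Qx , subst T Qw

    walk-reachable : ∀ {z x y} → Walk G U R z x → Walk G U R x y → Walk G (Walk G U R z) R x y
    walk-reachable z→x (nil _) = nil z→x
    walk-reachable z→x (cons _ r v) = cons z→x r (walk-reachable (snocʷ z→x r (walk-start v)) v)

  mapʷ : ∀ {U U' : Vertex G → Set} {R R' : Vertex G → Vertex G → Set} →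
    (∀ {x} → U x → U' x) → (∀ {x y} → R x y → R' x y) → ∀ {x y} → Walk G U R x y → Walk G U' R' x y
  mapʷ f g (nil ux) = nil (f ux)
  mapʷ f g (cons ux r w) = cons (f ux) (g r) (mapʷ f g w)

  record Path (U : Vertex G → Set) (x y : Vertex G) : Set where
    field
      len : ℕ
      at : ℕ → Vertex G
      at-0 : at 0 ≡ x
      at-len : at len ≡ y
      at-∈ : ∀ i → i ≤ len → U (at i)
      at-~ : ∀ i → i < len → at i ~ at (suc i)
      at-injective : ∀ i j → i ≤ len → j ≤ len → at i ≡ at j → i ≡ j

  trivial-path : ∀ {U x} → U x → Path U x x
  trivial-path {x = x} ux = record
    { len = 0 ; at = λ _ → x ; at-0 = refl ; at-len = refl ; at-∈ = λ _ _ → ux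
    ; at-~ = λ _ () ; at-injective = λ { _ _ z≤n z≤n _ → refl } }

  path-cons : ∀ {S : Vertex G → Bool} {u w v} → T (S u) → u ~ w → Path (T ∘ (S without u)) w v →
    Path (T ∘ S) u v
  path-cons {S} {u} Su u~w P = record
    { len = suc len ; at = at′ ; at-0 = refl ; at-len = at-len
    ; at-∈ = at′-∈ ; at-~ = at′-~ ; at-injective = at′-injective }
    where
      open Path P
      at′ : ℕ → Vertex G
      at′ zero = u
      at′ (suc i) = at i
      at′-∈ : ∀ i → i ≤ suc len → T (S (at′ i))
      at′-∈ zero _ = Su
      at′-∈ (suc i) (s≤s i≤) = proj₁ (without-⁻ S u (at-∈ i i≤))
      at′-~ : ∀ i → i < suc len → at′ i ~ at′ (suc i)
      at′-~ zero _ = subst (u ~_) (sym at-0) u~w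
      at′-~ (suc i) (s≤s i<) = at-~ i i<
      at′-injective : ∀ i j → i ≤ suc len → j ≤ suc len → at′ i ≡ at′ j → i ≡ j
      at′-injective zero zero _ _ _ = refl
      at′-injective zero (suc j) _ (s≤s j≤) e = ⊥-elim (proj₂ (without-⁻ S u (at-∈ j j≤)) (sym e))
      at′-injective (suc i) zero (s≤s i≤) _ e = ⊥-elim (proj₂ (without-⁻ S u (at-∈ i i≤)) e)
      at′-injective (suc i) (suc j) (s≤s i≤) (s≤s j≤) e = cong suc (at-injective i j i≤ j≤ e)

  path→walk : ∀ {U x y} → Path U x y → Walk G U _~_ x y
  path→walk {U} P = subst₂ (Walk G U _~_) at-0 at-len (from 0 len refl)
    where
      open Path P
      from : ∀ i k → i + k ≡ len → Walk G U _~_ (at i) (at len)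
      from i zero i+0≡ = subst (λ j → Walk G U _~_ (at i) (at j)) (trans (sym (+-identityʳ i)) i+0≡)
        (nil (at-∈ i (subst (i ≤_) i+0≡ (m≤m+n i 0))))
      from i (suc k) i+k≡ = cons (at-∈ i (subst (i ≤_) i+k≡ (m≤m+n i (suc k))))
        (at-~ i (subst (i <_) i+k≡ (m<m+n i (s≤s z≤n))))
        (from (suc i) k (trans (sym (+-suc i k)) i+k≡))

  walk-after-last-visit : ∀ {S : Vertex G → Bool} {u x v} → Walk G (T ∘ S) _~_ x v → ¬ u ≡ v →
    Walk G (T ∘ (S without u)) _~_ x v ⊎ Σ (Vertex G) λ w → u ~ w × Walk G (T ∘ (S without u)) _~_ w v
  walk-after-last-visit {S} {u} {x} (nil Sx) u≢v with x F.≟ u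
  ... | yes refl = ⊥-elim (u≢v refl)
  ... | no x≢u = inj₁ (nil (without-⁺ S Sx x≢u))
  walk-after-last-visit {S} {u} {x} (cons Sx x~w w→v) u≢v with walk-after-last-visit w→v u≢v
  ... | inj₂ suffix = inj₂ suffix
  ... | inj₁ w→v′ with x F.≟ u
  ...   | yes refl = inj₂ (_ , x~w , w→v′)
  ...   | no x≢u = inj₁ (cons (without-⁺ S Sx x≢u) x~w w→v′)

  -- Searching from the neighbours of u with u removed from S makes the path simple and the
  -- recursion well founded.
  path-or-unreachable : (S : Vertex G → Bool) → Acc _<_ (count S) →
    ∀ u v → Path (T ∘ S) u v ⊎ ¬ Walk G (T ∘ S) _~_ u v
  path-or-unreachable S (acc rs) u v with S u in Su
  ... | false = inj₂ λ w → subst T Su (walk-start w)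
  ... | true with u F.≟ v
  ...   | yes refl = inj₁ (trivial-path (subst T (sym Su) tt))
  ...   | no u≢v with search via-neighbour
    where
      via-neighbour : ∀ w → (u ~ w × Path (T ∘ (S without u)) w v) ⊎ ¬ (u ~ w × Walk G (T ∘ (S without u)) _~_ w v)
      via-neighbour w with T? (adj u w)
      ... | no ¬u~w = inj₂ (¬u~w ∘ proj₁)
      ... | yes u~w with path-or-unreachable (S without u) (rs (count-without S (subst T (sym Su) tt))) w v
      ...   | inj₁ P = inj₁ (u~w , P)
      ...   | inj₂ ¬W = inj₂ (¬W ∘ proj₂)
  ...     | inj₁ (w , u~w , P) = inj₁ (path-cons (subst T (sym Su) tt) u~w P)
  ...     | inj₂ none = inj₂ λ W → refute (walk-after-last-visit W u≢v)
    where
      refute : Walk G (T ∘ (S without u)) _~_ u v ⊎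
               Σ (Vertex G) (λ w → u ~ w × Walk G (T ∘ (S without u)) _~_ w v) → ⊥
      refute (inj₁ W′) = proj₂ (without-⁻ S u (walk-start W′)) refl
      refute (inj₂ (w , u~w , W′)) = none w (u~w , W′)

  reachable? : (Vertex G → Bool) → Vertex G → Vertex G → Bool
  reachable? S u v with path-or-unreachable S (<-wellFounded _) u v
  ... | inj₁ _ = true
  ... | inj₂ _ = false

  reachable-sound : ∀ {S u v} → T (reachable? S u v) → Walk G (T ∘ S) _~_ u v
  reachable-sound {S} {u} {v} t with path-or-unreachable S (<-wellFounded _) u v
  ... | inj₁ P = path→walk P

  reachable-complete : ∀ {S u v} → Walk G (T ∘ S) _~_ u v → T (reachable? S u v)
  reachable-complete {S} {u} {v} W with path-or-unreachable S (<-wellFounded _) u v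
  ... | inj₁ _ = tt
  ... | inj₂ ¬W = ¬W W

  walk→path : ∀ {S u v} → Walk G (T ∘ S) _~_ u v → Path (T ∘ S) u v
  walk→path {S} {u} {v} W with path-or-unreachable S (<-wellFounded _) u v
  ... | inj₁ P = P
  ... | inj₂ ¬W = ⊥-elim (¬W W)

  -- The cycle c 0, c 1, …, c m indexed by ℕ rather than by Fin, so that shifting and cutting it
  -- needs no Fin arithmetic.
  record Cycleℕ : Set where
    field
      m : ℕ
      2≤m : 2 ≤ m
      c : ℕ → Vertex G
      c-injective : ∀ i j → i ≤ m → j ≤ m → c i ≡ c j → i ≡ j
      c-~ : ∀ i → i < m → c i ~ c (suc i)
      c-closes : c m ~ c 0

  open Cycleℕ

  toCycle : Cycleℕ → Cycle G
  toCycle F = record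
    { m = m F ; len≥3 = s≤s (2≤m F) ; c = c F ∘ toℕ
    ; inj = λ {i} {j} e → toℕ-injective (c-injective F _ _ (toℕ≤pred[n] i) (toℕ≤pred[n] j) e)
    ; edges = edge }
    where
      edge : ∀ (i : Fin (suc (m F))) → c F (toℕ i) ~ c F (toℕ (csuc i))
      edge i with m≤n⇒m<n∨m≡n (toℕ≤pred[n] i)
      ... | inj₁ i<m = subst (λ k → c F (toℕ i) ~ c F k) (sym (toℕ-csuc i<m)) (c-~ F _ i<m)
      ... | inj₂ i≡m = subst₂ (λ k l → c F k ~ c F l)
        (sym i≡m) (cong toℕ (sym (csuc-last (<-irrefl i≡m)))) (c-closes F)

  fromCycle : Cycle G → Cycleℕ
  fromCycle C = record
    { m = m′ ; 2≤m = ℕ.s≤s⁻¹ len≥3 ; c = c′ ∘ index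
    ; c-injective = λ i j i≤m′ j≤m′ e →
        trans (sym (toℕ-index i≤m′)) (trans (cong toℕ (inj e)) (toℕ-index j≤m′))
    ; c-~ = λ i i<m′ → subst (λ k → c′ (index i) ~ c′ k) (csuc-index i<m′) (edges (index i))
    ; c-closes = subst (λ k → c′ (index m′) ~ c′ k) csuc-index-last (edges (index m′)) }
    where
      open Cycle C renaming (m to m′; c to c′)
      index : ℕ → Fin (suc m′)
      index k with k ℕ.<? suc m′
      ... | yes k<1+m′ = fromℕ< k<1+m′
      ... | no _ = F.zero
      toℕ-index : ∀ {k} → k ≤ m′ → toℕ (index k) ≡ k
      toℕ-index {k} k≤m′ with k ℕ.<? suc m′
      ... | yes k<1+m′ = toℕ-fromℕ< k<1+m′
      ... | no k≮1+m′ = ⊥-elim (k≮1+m′ (s≤s k≤m′))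
      csuc-index : ∀ {k} → k < m′ → csuc (index k) ≡ index (suc k)
      csuc-index {k} k<m′ = toℕ-injective (begin
        toℕ (csuc (index k))  ≡⟨ toℕ-csuc (subst (_< m′) (sym (toℕ-index (<⇒≤ k<m′))) k<m′) ⟩
        suc (toℕ (index k))   ≡⟨ cong suc (toℕ-index (<⇒≤ k<m′)) ⟩
        suc k                 ≡⟨ toℕ-index k<m′ ⟨
        toℕ (index (suc k))   ∎)
        where open ≡-Reasoning
      csuc-index-last : csuc (index m′) ≡ index 0
      csuc-index-last = trans (csuc-last (<-irrefl (toℕ-index ≤-refl))) (toℕ-injective (sym (toℕ-index z≤n)))

  On : Cycleℕ → Vertex G → Set
  On F v = Σ ℕ λ k → k ≤ m F × c F k ≡ v

  on-c : ∀ F {k} → k ≤ m F → On F (c F k)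
  on-c F k≤m = _ , k≤m , refl

  OnCycle⇒On : ∀ F {v} → OnCycle G (toCycle F) v → On F v
  OnCycle⇒On F (i , e) = toℕ i , toℕ≤pred[n] i , e

  On⇒OnCycle : ∀ F {v} → On F v → OnCycle G (toCycle F) v
  On⇒OnCycle F (k , k≤m , e) = fromℕ< (s≤s k≤m) , trans (cong (c F) (toℕ-fromℕ< (s≤s k≤m))) e

  on? : ∀ F v → Dec (On F v)
  on? F v = map′ (OnCycle⇒On F) (On⇒OnCycle F) (any? λ i → c F (toℕ i) F.≟ v)

  off? : Cycleℕ → Vertex G → Bool
  off? F v = ⌊ ¬? (on? F v) ⌋

  off-sound : ∀ F {v} → T (off? F v) → ¬ On F v
  off-sound F {v} = toWitness {a? = ¬? (on? F v)}

  off-complete : ∀ F {v} → ¬ On F v → T (off? F v)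
  off-complete F {v} = fromWitness {a? = ¬? (on? F v)}

  On-fromCycle : ∀ C {v} → On (fromCycle C) v → OnCycle G C v
  On-fromCycle C (_ , _ , e) = _ , e

  infix 4 _⊆ᵥ_
  _⊆ᵥ_ : Cycleℕ → Cycleℕ → Set
  F′ ⊆ᵥ F = ∀ {v} → On F′ v → On F v

  Chord : Cycleℕ → Set
  Chord F = Σ (Fin (suc (m F))) λ i → Σ (Fin (suc (m F))) λ j →
    c F (toℕ i) ~ c F (toℕ j) × ¬ j ≡ csuc i × ¬ i ≡ csuc j

  induced-or-chord : ∀ F → Induced G (toCycle F) ⊎ Chord F
  induced-or-chord F with any? (λ i → any? (λ j →
    T? (adj (c F (toℕ i)) (c F (toℕ j))) ×-dec ¬? (j F.≟ csuc i) ×-dec ¬? (i F.≟ csuc j)))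
  ... | yes chord = inj₂ chord
  ... | no ¬chord = inj₁ consecutive
    where
      consecutive : Induced G (toCycle F)
      consecutive i j i~j with j F.≟ csuc i | i F.≟ csuc j
      ... | yes j≡ | _ = inj₁ j≡
      ... | no _ | yes i≡ = inj₂ i≡
      ... | no j≢ | no i≢ = ⊥-elim (¬chord (i , j , i~j , j≢ , i≢))

  chord-cycle : ∀ F a d → 2 ≤ d → a + d ≤ m F → c F a ~ c F (a + d) →
    Σ Cycleℕ λ F′ → m F′ ≡ d × F′ ⊆ᵥ F
  chord-cycle F a d 2≤d a+d≤m a~a+d = F′ , refl , λ (k , k≤d , e) → a + k , shift k≤d , e
    where
      shift : ∀ {k} → k ≤ d → a + k ≤ m F
      shift k≤d = ≤-trans (+-monoʳ-≤ a k≤d) a+d≤m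
      F′ : Cycleℕ
      F′ = record
        { m = d ; 2≤m = 2≤d ; c = λ k → c F (a + k)
        ; c-injective = λ i j i≤d j≤d e → +-cancelˡ-≡ a i j (c-injective F _ _ (shift i≤d) (shift j≤d) e)
        ; c-~ = λ i i<d → subst (λ k → c F (a + i) ~ c F k) (sym (+-suc a i))
            (c-~ F (a + i) (subst (_≤ m F) (+-suc a i) (shift i<d)))
        ; c-closes = subst (λ k → c F (a + d) ~ c F k) (sym (+-identityʳ a)) (~-sym a~a+d) }

  shorter-cycle-ordered : ∀ F (i j : Fin (suc (m F))) → toℕ i < toℕ j → c F (toℕ i) ~ c F (toℕ j) →
    ¬ j ≡ csuc i → ¬ i ≡ csuc j → Σ Cycleℕ λ F′ → m F′ < m F × F′ ⊆ᵥ F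
  shorter-cycle-ordered F i j i<j i~j j≢ i≢ with chord-cycle F (toℕ i) (toℕ j ∸ toℕ i) 2≤d
    (subst (_≤ m F) (sym i+d≡j) (toℕ≤pred[n] j)) (subst (λ k → c F (toℕ i) ~ c F k) (sym i+d≡j) i~j)
    where
      i+d≡j : toℕ i + (toℕ j ∸ toℕ i) ≡ toℕ j
      i+d≡j = m+[n∸m]≡n (<⇒≤ i<j)
      2≤d : 2 ≤ toℕ j ∸ toℕ i
      2≤d = m<n∧n≢1+m⇒2≤n∸m i<j λ j≡ →
        j≢ (toℕ-injective (trans j≡ (sym (toℕ-csuc (<-≤-trans i<j (toℕ≤pred[n] j))))))
  ... | F′ , m′≡d , F′⊆F = F′ , subst (_< m F) (sym m′≡d) d<m , F′⊆F
    where
      d<m : toℕ j ∸ toℕ i < m F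
      d<m = m<n≤o⇒n∸m<o i<j (toℕ≤pred[n] j) λ (i≡0 , j≡m) →
        i≢ (trans (toℕ-injective {j = F.zero} i≡0) (sym (csuc-last (<-irrefl j≡m))))

  shorter-cycle : ∀ F → Chord F → Σ Cycleℕ λ F′ → m F′ < m F × F′ ⊆ᵥ F
  shorter-cycle F (i , j , i~j , j≢ , i≢) with <-cmp (toℕ i) (toℕ j)
  ... | tri< i<j _ _ = shorter-cycle-ordered F i j i<j i~j j≢ i≢
  ... | tri≈ _ i≡j _ = ⊥-elim (~-irrefl i~j (cong (c F) i≡j))
  ... | tri> _ _ j<i = shorter-cycle-ordered F j i j<i (~-sym i~j) i≢ j≢

  induced-subcycle : ∀ F → Acc _<_ (m F) → Σ Cycleℕ λ F′ → Induced G (toCycle F′) × F′ ⊆ᵥ F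
  induced-subcycle F (acc rs) with induced-or-chord F
  ... | inj₁ induced = F , induced , id
  ... | inj₂ chord with shorter-cycle F chord
  ...   | F′ , m′<m , F′⊆F with induced-subcycle F′ (rs m′<m)
  ...     | F″ , induced , F″⊆F′ = F″ , induced , F′⊆F ∘ F″⊆F′

  0<m : ∀ F → 0 < m F
  0<m F = <-≤-trans (s≤s z≤n) (2≤m F)

  last-predecessor : ∀ F → c F (pred (m F)) ~ c F (m F)
  last-predecessor F = subst (λ k → c F (pred (m F)) ~ c F k) 1+pred≡m (c-~ F _ (≤-reflexive 1+pred≡m))
    where
      1+pred≡m : suc (pred (m F)) ≡ m F
      1+pred≡m = suc-pred (m F) ⦃ >-nonZero (0<m F) ⦄

  rotate : Cycleℕ → Cycleℕ
  rotate F = record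
    { m = m F ; 2≤m = 2≤m F ; c = c F ∘ σ
    ; c-injective = λ i j i≤m j≤m e → cyclic-suc-injective i≤m j≤m
        (c-injective F _ _ (cyclic-suc-≤ i≤m) (cyclic-suc-≤ j≤m) e)
    ; c-~ = step
    ; c-closes = subst₂ (λ k l → c F k ~ c F l) (sym (cyclic-suc-last (m F))) (sym (cyclic-suc-< (0<m F)))
        (c-~ F 0 (0<m F)) }
    where
      σ : ℕ → ℕ
      σ = cyclic-suc (m F)
      step : ∀ i → i < m F → c F (σ i) ~ c F (σ (suc i))
      step i i<m with m≤n⇒m<n∨m≡n i<m
      ... | inj₁ 1+i<m = subst₂ (λ k l → c F k ~ c F l) (sym (cyclic-suc-< i<m)) (sym (cyclic-suc-< 1+i<m))
        (c-~ F (suc i) 1+i<m)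
      ... | inj₂ 1+i≡m = subst₂ (λ k l → c F k ~ c F l)
        (trans (sym 1+i≡m) (sym (cyclic-suc-< i<m))) (sym (trans (cong σ 1+i≡m) (cyclic-suc-last (m F))))
        (c-closes F)

  rotate-⊆ᵥ : ∀ F → rotate F ⊆ᵥ F
  rotate-⊆ᵥ F (k , k≤m , e) = cyclic-suc (m F) k , cyclic-suc-≤ k≤m , e

  ⊆ᵥ-rotate : ∀ F → F ⊆ᵥ rotate F
  ⊆ᵥ-rotate F (k , k≤m , e) with cyclic-suc-surjective k≤m
  ... | k′ , k′≤m , σk′≡k = k′ , k′≤m , trans (cong (c F) σk′≡k) e

  rotate-to-last : ∀ F κ → κ ≤ m F →
    Σ Cycleℕ λ F′ → c F′ (m F′) ≡ c F κ × F′ ⊆ᵥ F × F ⊆ᵥ F′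
  rotate-to-last F zero _ = rotate F , cong (c F) (cyclic-suc-last (m F)) , rotate-⊆ᵥ F , ⊆ᵥ-rotate F
  rotate-to-last F (suc κ) κ<m with rotate-to-last (rotate F) κ (<⇒≤ κ<m)
  ... | F′ , last≡ , F′⊆ , ⊆F′ =
    F′ , trans last≡ (cong (c F) (cyclic-suc-< κ<m)) , rotate-⊆ᵥ F ∘ F′⊆ , ⊆F′ ∘ ⊆ᵥ-rotate F

  cycle-through : ∀ {U x y z} → Path U y z → (∀ {v} → U v → ¬ v ≡ x) → x ~ y → z ~ x → ¬ y ≡ z →
    Σ Cycleℕ λ N → ∀ {v} → On N v → v ≡ x ⊎ U v
  cycle-through {U} {x} {y} {z} P U∌x x~y z~x y≢z = N , on-N
    where
      open Path P
      c′ : ℕ → Vertex G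
      c′ zero = x
      c′ (suc k) = at k
      2≤1+len : 2 ≤ suc len
      2≤1+len with len in len≡
      ... | zero = ⊥-elim (y≢z (trans (sym at-0) (trans (cong at (sym len≡)) at-len)))
      ... | suc _ = s≤s (s≤s z≤n)
      injective : ∀ i j → i ≤ suc len → j ≤ suc len → c′ i ≡ c′ j → i ≡ j
      injective zero zero _ _ _ = refl
      injective zero (suc j) _ (s≤s j≤) e = ⊥-elim (U∌x (at-∈ j j≤) (sym e))
      injective (suc i) zero (s≤s i≤) _ e = ⊥-elim (U∌x (at-∈ i i≤) e)
      injective (suc i) (suc j) (s≤s i≤) (s≤s j≤) e = cong suc (at-injective i j i≤ j≤ e)
      step : ∀ i → i < suc len → c′ i ~ c′ (suc i)
      step zero _ = subst (x ~_) (sym at-0) x~y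
      step (suc i) (s≤s i<) = at-~ i i<
      N : Cycleℕ
      N = record
        { m = suc len ; 2≤m = 2≤1+len ; c = c′ ; c-injective = injective ; c-~ = step
        ; c-closes = subst (_~ x) (sym at-len) z~x }
      on-N : ∀ {v} → On N v → v ≡ x ⊎ U v
      on-N (zero , _ , e) = inj₁ (sym e)
      on-N (suc k , s≤s k≤ , e) = inj₂ (subst U e (at-∈ k k≤))

  arc : ∀ F {U : Vertex G → Set} a b → a ≤ b → b ≤ m F → (∀ i → a ≤ i → i ≤ b → U (c F i)) →
    Walk G U _~_ (c F a) (c F b)
  arc F a zero a≤0 _ inU = subst (λ k → Walk G _ _~_ (c F k) (c F 0)) (sym (n≤0⇒n≡0 a≤0)) (nil (inU 0 a≤0 z≤n))
  arc F a (suc b) a≤1+b 1+b≤m inU with a ℕ.≤? b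
  ... | yes a≤b = snocʷ (arc F a b a≤b (<⇒≤ 1+b≤m) (λ i a≤i i≤b → inU i a≤i (m≤n⇒m≤1+n i≤b)))
                        (c-~ F b 1+b≤m) (inU (suc b) a≤1+b ≤-refl)
  ... | no a≰b = subst (λ k → Walk G _ _~_ (c F k) (c F (suc b))) (sym (≤-antisym a≤1+b (≰⇒> a≰b)))
                        (nil (inU (suc b) a≤1+b ≤-refl))

  detour : ∀ F {U : Vertex G → Set} α β → α < m F → β < m F → ¬ α ≡ β →
    (∀ i → i < m F → ¬ i ≡ α → U (c F i)) →
    Σ (Vertex G) λ y → c F α ~ y × On F y × Walk G U _~_ y (c F β)
  detour F {U} α β α<m β<m α≢β inU with <-cmp α β
  ... | tri< α<β _ _ = c F (suc α) , c-~ F α α<m , on-c F α<m ,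
    arc F (suc α) β α<β (<⇒≤ β<m) λ i α<i i≤β →
      inU i (≤-<-trans i≤β β<m) (>⇒≢ (<-≤-trans (n<1+n α) α<i))
  ... | tri≈ _ α≡β _ = ⊥-elim (α≢β α≡β)
  detour F {U} (suc α) β 1+α<m β<m α≢β inU | tri> _ _ (s≤s β≤α) =
    c F α , ~-sym (c-~ F α α<m) , on-c F (<⇒≤ α<m) ,
    reverseʷ ~-sym (arc F β α β≤α (<⇒≤ α<m) λ i _ i≤α → inU i (≤-<-trans i≤α α<m) (<⇒≢ (s≤s i≤α)))
    where
      α<m : α < m F
      α<m = <-trans (n<1+n α) 1+α<m

  record Attachment (F : Cycleℕ) (s : Vertex G) (U : Vertex G → Set) : Set where
    field
      pos : ℕ
      pos≤m : pos ≤ m F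
      foot : Vertex G
      foot-reachable : Walk G (T ∘ off? F) _~_ s foot
      foot~ : foot ~ c F pos
      U-pos : U (c F pos)

  open Attachment

  attachment : ∀ F {s U x y} → Walk G U _~_ x y →
    T (reachable? (off? F) s x) → ¬ T (reachable? (off? F) s y) → Attachment F s U
  attachment F {s} {U} W x∈ y∉ with walk-exit (reachable? (off? F) s) W x∈ y∉
  ... | p , q , _ , Uq , p~q , p∈ , q∉ with on? F q
  ...   | yes (k , k≤m , ck≡q) = record
    { pos = k ; pos≤m = k≤m ; foot = p ; foot-reachable = reachable-sound p∈
    ; foot~ = subst (p ~_) (sym ck≡q) p~q ; U-pos = subst U (sym ck≡q) Uq }
  ...   | no q∉F = ⊥-elim (q∉ (reachable-complete (snocʷ (reachable-sound p∈) p~q (off-complete F q∉F))))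

  module _ (connected : Connected G) (connected-without : ∀ x → ConnectedOn G (λ v → ¬ v ≡ x) _~_)
           (V : Vertex G → Set) {v₀ : Vertex G} (v₀∈V : V v₀)
           (V-connected : ∀ {w} → V w → Walk G V _~_ v₀ w) (degree≥4⇒V : ∀ v → degree G v ≥ 4 → V v) where

    Avoids : Cycleℕ → Set
    Avoids F = ∀ {v} → On F v → ¬ V v

    component : Cycleℕ → Vertex G → Bool
    component F = reachable? (off? F) v₀

    size : Cycleℕ → ℕ
    size F = count (component F)

    component-off : ∀ F {w} → T (component F w) → ¬ On F w
    component-off F w∈K = off-sound F (walk-end (reachable-sound w∈K))

    V⊆component : ∀ F → Avoids F → ∀ {w} → V w → T (component F w)
    V⊆component F avoids w∈V =
      reachable-complete (mapʷ (λ v∈V → off-complete F λ on → avoids on v∈V) id (V-connected w∈V))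

    component-grows : ∀ F F′ → (∀ {v} → On F′ v → ¬ T (component F v)) →
      ∀ {w} → T (component F w) → T (component F′ w)
    component-grows F F′ F′∩K≡∅ {w} w∈K = reachable-complete
      (mapʷ (λ v₀→v → off-complete F′ λ on → F′∩K≡∅ on (reachable-complete v₀→v)) id
        (walk-reachable (nil (walk-start v₀→w)) v₀→w))
      where
        v₀→w : Walk G (T ∘ off? F) _~_ v₀ w
        v₀→w = reachable-sound w∈K

    component-⊆ᵥ : ∀ F F′ → F′ ⊆ᵥ F → ∀ {w} → T (component F w) → T (component F′ w)
    component-⊆ᵥ F F′ F′⊆F = component-grows F F′ λ on w∈K → component-off F w∈K (F′⊆F on)

    size-grows : ∀ F N {x z} → (∀ {v} → On N v → ¬ T (component F v) × ¬ v ≡ x) →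
      ¬ T (component F x) → z ~ x → T (component F z) → size F < size N
    size-grows F N {x} N-avoids x∉K z~x z∈K = count-strict (λ _ → grow) x x∉K
      (reachable-complete (snocʷ (reachable-sound (grow z∈K)) z~x (off-complete N λ on → proj₂ (N-avoids on) refl)))
      where
        grow : ∀ {w} → T (component F w) → T (component N w)
        grow = component-grows F N (proj₁ ∘ N-avoids)

    four-neighbours⇒V : ∀ {v a b c d} → v ~ a → v ~ b → v ~ c → v ~ d →
      ¬ a ≡ b → ¬ a ≡ c → ¬ a ≡ d → ¬ b ≡ c → ¬ b ≡ d → ¬ c ≡ d → V v
    four-neighbours⇒V {v} v~a v~b v~c v~d a≢b a≢c a≢d b≢c b≢d c≢d =
      degree≥4⇒V v (four≤count v~a v~b v~c v~d a≢b a≢c a≢d b≢c b≢d c≢d)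

    Improvement : Cycleℕ → Set
    Improvement F = Σ Cycleℕ λ F′ → Induced G (toCycle F′) × Avoids F′ × size F < size F′

    module AttachedAtLast (F : Cycleℕ) (avoids : Avoids F) {u z : Vertex G}
      (u∉F : ¬ On F u) (u∉K : ¬ T (component F u)) (z∈K : T (component F z)) (z~last : z ~ c F (m F)) where

      Off : Vertex G → Set
      Off = T ∘ off? F

      reachable-from-u⇒∉K : ∀ {w} → Walk G Off _~_ u w → ¬ T (component F w)
      reachable-from-u⇒∉K u→w w∈K = u∉K (reachable-complete (reachable-sound w∈K ++ʷ reverseʷ ~-sym u→w))

      attachment-from-u : ∀ {U} → Walk G U _~_ u v₀ → Attachment F u U
      attachment-from-u W = attachment F W (reachable-complete (nil (off-complete F u∉F)))
        λ v₀∈Kᵤ → reachable-from-u⇒∉K (reachable-sound v₀∈Kᵤ) (V⊆component F avoids v₀∈V)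

      foot-off : ∀ {U} (a : Attachment F u U) → ¬ On F (foot a)
      foot-off a = off-sound F (walk-end (foot-reachable a))

      last-unattached : ∀ {U} (a : Attachment F u U) → ¬ pos a ≡ m F
      last-unattached a refl = avoids (on-c F ≤-refl) (four-neighbours⇒V
        (~-sym z~last) (~-sym (foot~ a)) (~-sym (last-predecessor F)) (c-closes F)
        (λ z≡foot → reachable-from-u⇒∉K (foot-reachable a) (subst (T ∘ component F) z≡foot z∈K))
        (λ z≡ → component-off F z∈K (subst (On F) (sym z≡) (on-c F pred≤m)))
        (λ z≡ → component-off F z∈K (subst (On F) (sym z≡) (on-c F z≤n)))
        (λ foot≡ → foot-off a (subst (On F) (sym foot≡) (on-c F pred≤m)))
        (λ foot≡ → foot-off a (subst (On F) (sym foot≡) (on-c F z≤n)))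
        (λ e → <⇒≢ (pred-mono-≤ (2≤m F)) (sym (c-injective F _ _ pred≤m z≤n e))))
        where
          pred≤m : pred (m F) ≤ m F
          pred≤m = pred[n]≤n

      -- The new cycle runs from c α along F, away from c m, to c β, then through the component of u
      -- back to c α; it misses c m and the component of v₀.
      module _ (a₁ : Attachment F u (λ _ → ⊤)) (a₂ : Attachment F u (λ v → ¬ v ≡ c F (pos a₁))) where

        α β : ℕ
        α = pos a₁
        β = pos a₂

        α<m : α < m F
        α<m = ≤∧≢⇒< (pos≤m a₁) (last-unattached a₁)

        β<m : β < m F
        β<m = ≤∧≢⇒< (pos≤m a₂) (last-unattached a₂)

        α≢β : ¬ α ≡ β
        α≢β α≡β = U-pos a₂ (cong (c F) (sym α≡β))

        S′ : Vertex G → Bool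
        S′ = ((not ∘ component F) without c F (m F)) without c F α

        S′-⁺ : ∀ {w} → ¬ T (component F w) → ¬ w ≡ c F (m F) → ¬ w ≡ c F α → T (S′ w)
        S′-⁺ w∉K w≢last w≢cα = without-⁺ _ (without-⁺ _ (¬T⇒T-not w∉K) w≢last) w≢cα

        S′-⁻ : ∀ {w} → T (S′ w) → ¬ T (component F w) × ¬ w ≡ c F (m F) × ¬ w ≡ c F α
        S′-⁻ t with without-⁻ _ _ t
        ... | t′ , w≢cα with without-⁻ _ _ t′
        ...   | t″ , w≢last = T-not⇒¬T t″ , w≢last , w≢cα

        cycle-vertex-in-S′ : ∀ i → i < m F → ¬ i ≡ α → T (S′ (c F i))
        cycle-vertex-in-S′ i i<m i≢α = S′-⁺ (λ k → component-off F k (on-c F (<⇒≤ i<m)))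
          (λ e → <⇒≢ i<m (c-injective F _ _ (<⇒≤ i<m) ≤-refl e))
          (λ e → i≢α (c-injective F _ _ (<⇒≤ i<m) (pos≤m a₁) e))

        reachable-in-S′ : ∀ {w} → Walk G Off _~_ u w → T (S′ w)
        reachable-in-S′ u→w = S′-⁺ (reachable-from-u⇒∉K u→w)
          (λ e → off-sound F (walk-end u→w) (subst (On F) (sym e) (on-c F ≤-refl)))
          (λ e → off-sound F (walk-end u→w) (subst (On F) (sym e) (on-c F (pos≤m a₁))))

        walk-around : Σ (Vertex G) λ y → c F α ~ y × On F y × Walk G (T ∘ S′) _~_ y (foot a₁)
        walk-around with detour F α β α<m β<m α≢β cycle-vertex-in-S′
        ... | y , α~y , y∈F , y→cβ = y , α~y , y∈F ,
          (y→cβ ++ʷ cons (cycle-vertex-in-S′ β β<m (α≢β ∘ sym)) (~-sym (foot~ a₂)) foot₂→foot₁)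
          where
            foot₂→foot₁ : Walk G (T ∘ S′) _~_ (foot a₂) (foot a₁)
            foot₂→foot₁ = mapʷ reachable-in-S′ id
              (walk-reachable (foot-reachable a₂) (reverseʷ ~-sym (foot-reachable a₂) ++ʷ foot-reachable a₁))

        new-cycle : Σ Cycleℕ λ N → ∀ {v} → On N v → v ≡ c F α ⊎ T (S′ v)
        new-cycle with walk-around
        ... | y , α~y , y∈F , W = cycle-through (walk→path W) (proj₂ ∘ proj₂ ∘ S′-⁻) α~y (foot~ a₁)
          λ y≡foot → foot-off a₁ (subst (On F) y≡foot y∈F)

        improvement : Improvement F
        improvement with new-cycle
        ... | N , N⊆ with induced-subcycle N (<-wellFounded _)
        ...   | N′ , induced , N′⊆N =
          N′ , induced , (λ on v∈V → proj₁ (N′-avoids on) (V⊆component F avoids v∈V)) ,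
          size-grows F N′ N′-avoids (λ k → component-off F k (on-c F ≤-refl)) z~last z∈K
          where
            N′-avoids : ∀ {v} → On N′ v → ¬ T (component F v) × ¬ v ≡ c F (m F)
            N′-avoids on with N⊆ (N′⊆N on)
            ... | inj₁ refl = (λ k → component-off F k (on-c F (pos≤m a₁))) ,
                              (λ e → last-unattached a₁ (c-injective F _ _ (pos≤m a₁) ≤-refl e))
            ... | inj₂ S′v = proj₁ (S′-⁻ S′v) , proj₁ (proj₂ (S′-⁻ S′v))

      improvement-at-last : Improvement F
      improvement-at-last = improvement a₁ a₂
        where
          a₁ : Attachment F u (λ _ → ⊤)
          a₁ = attachment-from-u (proj₂ connected u v₀ tt tt)
          x : Vertex G
          x = c F (pos a₁)
          a₂ : Attachment F u (λ v → ¬ v ≡ x)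
          a₂ = attachment-from-u (proj₂ (connected-without x) u v₀
            (λ u≡x → u∉F (subst (On F) (sym u≡x) (on-c F (pos≤m a₁))))
            (λ v₀≡x → avoids (subst (On F) (sym v₀≡x) (on-c F (pos≤m a₁))) v₀∈V))

    Uncovered Covered : Cycleℕ → Set
    Uncovered F = Σ (Vertex G) λ u → ¬ On F u × ¬ T (component F u)
    Covered F = ∀ w → On F w ⊎ T (component F w)

    improve-via : ∀ F → Avoids F → ∀ {u} → ¬ On F u → ¬ T (component F u) →
      Attachment F v₀ (λ _ → ⊤) → Improvement F
    improve-via F avoids {u} u∉F u∉K a = via-rotation (rotate-to-last F (pos a) (pos≤m a))
      where
        via-rotation : (Σ Cycleℕ λ R → c R (m R) ≡ c F (pos a) × R ⊆ᵥ F × F ⊆ᵥ R) → Improvement F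
        via-rotation (R , last≡ , R⊆F , F⊆R) = lift (AttachedAtLast.improvement-at-last R (avoids ∘ R⊆F) {u} {foot a}
          (u∉F ∘ R⊆F) (u∉K ∘ component-⊆ᵥ R F F⊆R)
          (component-⊆ᵥ F R R⊆F (reachable-complete (foot-reachable a)))
          (subst (foot a ~_) (sym last≡) (foot~ a)))
          where
            lift : Improvement R → Improvement F
            lift (F′ , induced , avoids′ , size<) =
              F′ , induced , avoids′ ,
              ≤-<-trans (count-mono {p = component F} {q = component R} λ _ → component-⊆ᵥ F R R⊆F) size<

    improve : ∀ F → Avoids F → ∀ {u} → ¬ On F u → ¬ T (component F u) → Improvement F
    improve F avoids u∉F u∉K = improve-via F avoids u∉F u∉K
      (attachment F (proj₂ connected v₀ (c F 0) tt tt) (V⊆component F avoids v₀∈V)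
        (λ k → component-off F k (on-c F z≤n)))

    complement-connected : ∀ F → Avoids F → Covered F →
      ConnectedOn G (λ v → ¬ OnCycle G (toCycle F) v) _~_
    complement-connected F avoids covered =
      (v₀ , λ on → avoids (OnCycle⇒On F on) v₀∈V) ,
      λ x y x∉F y∉F → reverseʷ ~-sym (from-v₀ x∉F) ++ʷ from-v₀ y∉F
      where
        from-v₀ : ∀ {x} → ¬ OnCycle G (toCycle F) x → Walk G (λ v → ¬ OnCycle G (toCycle F) v) _~_ v₀ x
        from-v₀ {x} x∉F with covered x
        ... | inj₁ x∈F = ⊥-elim (x∉F (On⇒OnCycle F x∈F))
        ... | inj₂ x∈K = mapʷ (λ off on → off-sound F off (OnCycle⇒On F on)) id (reachable-sound x∈K)

    GoodCycle : Set
    GoodCycle = Σ Cycleℕ λ F →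
      Avoids F × Induced G (toCycle F) × ConnectedOn G (λ v → ¬ OnCycle G (toCycle F) v) _~_

    uncovered-or-covered : ∀ F → Uncovered F ⊎ Covered F
    uncovered-or-covered F = search classify
      where
        classify : ∀ w → (¬ On F w × ¬ T (component F w)) ⊎ (On F w ⊎ T (component F w))
        classify w with on? F w | T? (component F w)
        ... | yes w∈F | _ = inj₂ (inj₁ w∈F)
        ... | no _ | yes w∈K = inj₂ (inj₂ w∈K)
        ... | no w∉F | no w∉K = inj₁ (w∉F , w∉K)

    good-cycle : ∀ F → Induced G (toCycle F) → Avoids F → Acc _<_ (n ∸ size F) → GoodCycle
    good-cycle F induced avoids (acc rs) = continue (uncovered-or-covered F)
      where
        next : Improvement F → GoodCycle
        next (F′ , induced′ , avoids′ , size<) =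
          good-cycle F′ induced′ avoids′ (rs (∸-monoʳ-< {n} {size F′} {size F} size< (count≤ (component F′))))
        continue : Uncovered F ⊎ Covered F → GoodCycle
        continue (inj₁ (_ , u∉F , u∉K)) = next (improve F avoids u∉F u∉K)
        continue (inj₂ covered) = F , avoids , induced , complement-connected F avoids covered

lemma4p2 : (G : Graph) → TwoConnected G →
    (G' : Subgraph G) → SubgraphConnected G G' →
    (∀ v → degree G v ≥ 4 → Subgraph.V G' v) →
    (∃[ C ] CycleAvoids G (Subgraph.V G') C) →
    ∃[ C ] (CycleAvoids G (Subgraph.V G') C × Induced G C ×
            ConnectedOn G (λ v → ¬ OnCycle G C v) (Adj G))
lemma4p2 G (_ , connected , connected-without) G' ((v₀ , v₀∈V) , G'-connected) degree≥4⇒V (C₀ , C₀-avoids)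
  with induced-subcycle G (fromCycle G C₀) (<-wellFounded _)
... | F , induced , F⊆C₀ with good-cycle G connected connected-without V v₀∈V V-connected degree≥4⇒V
                               F induced F-avoids (<-wellFounded _)
  where
    V : Vertex G → Set
    V = Subgraph.V G'
    V-connected : ∀ {w} → V w → Walk G V (Adj G) v₀ w
    V-connected w∈V = mapʷ G id (Subgraph.E-adj G') (G'-connected v₀ _ v₀∈V w∈V)
    F-avoids : ∀ {v} → On G F v → ¬ V v
    F-avoids on v∈V with On-fromCycle G C₀ (F⊆C₀ on)
    ... | i , cᵢ≡v = C₀-avoids i (subst V (sym cᵢ≡v) v∈V)
... | F′ , avoids , induced′ , connected′ =
  toCycle G F′ , (λ i → avoids (OnCycle⇒On G F′ (i , refl))) , induced′ , connected′
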